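{- For all integers $m,n\ge 2$, the number of spotlight tilings of an $m\times n$ rectangle with its southeast corner square removed is $$T_{m,n}-\binom{m+n-2}{m-1}=\binom{m+n}{m}-2\binom{m+n-2}{m-1},$$ where $T_{m,n}$ is the number of spotlight tilings of the $m\times n$ rectangle.
   Context: A region is a finite set of unit squares of the square grid whose edge-adjacency graph is connected. A northwest corner of a region $R$ is a square of $R$ such that neither the square directly above it nor the square directly to its left belongs to $R$. A spotlight tiling of $R$ is produced recursively: choose a northwest corner $s$ of $R$ and place a spotlight with endpoint $s$, extending either east or south as far as possible, i.e. consisting of $s$ together with the maximal run of consecutive squares of $R$ in that direction. The uncovered squares form a disjoint union of regions (connected components), each of which is then given a spotlight tiling recursively; the empty region has exactly one (empty) tiling. The spotlight tiling is the final collection of spotlights; two spotlight tilings are the same if and only if they give the same collection of spotlights (order of placement is irrelevant, and a last-placed spotlight of length $1$ carries no direction). -}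

module Defs where

open import Data.Nat using (ℕ; zero; suc; _+_; _∸_; _≤_; _<_)
import Data.Nat.Properties as ℕP
open import Data.Product using (Σ; _×_; _,_; ∃)
open import Data.Product.Properties using (≡-dec)
open import Data.Sum using (_⊎_)
open import Data.List using (List; []; _∷_; _++_; map; upTo; concatMap; filter; length)
open import Data.List.Membership.Propositional using (_∈_; _∉_)
open import Data.List.Relation.Unary.All using (All)
open import Data.List.Relation.Unary.Any using (Any)
open import Data.List.Relation.Unary.AllPairs using (AllPairs)
open import Relation.Binary.PropositionalEquality using (_≡_)
open import Relation.Nullary using (¬_)
open import Relation.Nullary.Decidable using (¬?)

-- A unit square of the grid: (row , column).  Rows increase to the SOUTH,
-- columns increase to the EAST.
Sq : Set
Sq = ℕ × ℕ

-- Finite sets of squares, represented by lists (membership is what matters).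
SqSet : Set
SqSet = List Sq

_≋_ : SqSet → SqSet → Set
A ≋ B = ∀ x → (x ∈ A → x ∈ B) × (x ∈ B → x ∈ A)

Adj : Sq → Sq → Set
Adj (i , j) (i′ , j′) =
  (i ≡ i′ × (suc j ≡ j′ ⊎ suc j′ ≡ j)) ⊎ (j ≡ j′ × (suc i ≡ i′ ⊎ suc i′ ≡ i))

data Path (R : SqSet) : Sq → Sq → Set where
  here : ∀ {a} → Path R a a
  step : ∀ {a b c} → Adj a b → b ∈ R → Path R b c → Path R a c

Connected : SqSet → Set
Connected R = ∀ a b → a ∈ R → b ∈ R → Path R a b

NWCorner : SqSet → Sq → Set
NWCorner R (i , j) =
  (i , j) ∈ R
  × (∀ i′ → suc i′ ≡ i → (i′ , j) ∉ R)
  × (∀ j′ → suc j′ ≡ j → (i , j′) ∉ R)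

data Dir : Set where
  east south : Dir

shift : Dir → Sq → ℕ → Sq
shift east  (i , j) t = (i , j + t)
shift south (i , j) t = (i + t , j)

Spotlight : SqSet → Sq → Dir → SqSet → Set
Spotlight R s d S = Σ ℕ λ k →
  (∀ t → t ≤ k → shift d s t ∈ R)
  × shift d s (suc k) ∉ R
  × S ≡ map (shift d s) (upTo (suc k))

Tiling : Set
Tiling = List SqSet

mutual
  data SpotlightTiling (R : SqSet) : Tiling → Set where
    empty : (∀ x → x ∉ R) → SpotlightTiling R []
    place : ∀ s d S U T →
            NWCorner R s →
            Spotlight R s d S →
            (∀ x → (x ∈ U → x ∈ R × x ∉ S) × (x ∈ R × x ∉ S → x ∈ U)) →
            ComponentsTiling U T →
            SpotlightTiling R (S ∷ T)

  -- Tilings of an arbitrary finite set U, obtained by tiling each of its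
  -- connected components (a nonempty connected part A with no square of A
  -- adjacent to or equal to a square of the rest B) recursively.
  data ComponentsTiling (U : SqSet) : Tiling → Set where
    none : (∀ x → x ∉ U) → ComponentsTiling U []
    comp : ∀ A B TA TB →
           (∃ λ a → a ∈ A) →
           Connected A →
           (∀ a b → a ∈ A → b ∈ B → ¬ (a ≡ b) × ¬ Adj a b) →
           U ≋ (A ++ B) →
           SpotlightTiling A TA →
           ComponentsTiling B TB →
           ComponentsTiling U (TA ++ TB)

SameTiling : Tiling → Tiling → Set
SameTiling T T′ = ∀ S →
  (Any (_≋ S) T → Any (_≋ S) T′) × (Any (_≋ S) T′ → Any (_≋ S) T)

NumSpotlightTilings : SqSet → ℕ → Set
NumSpotlightTilings R N = Σ (List Tiling) λ L →
  length L ≡ N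
  × All (SpotlightTiling R) L
  × (∀ T → SpotlightTiling R T → Any (SameTiling T) L)
  × AllPairs (λ T T′ → ¬ SameTiling T T′) L

_≟Sq_ : (a b : Sq) → Relation.Nullary.Dec (a ≡ b)
_≟Sq_ = ≡-dec ℕP._≟_ ℕP._≟_

rect : ℕ → ℕ → SqSet
rect m n = concatMap (λ i → map (i ,_) (upTo n)) (upTo m)

rectMinusSE : ℕ → ℕ → SqSet
rectMinusSE m n = filter (λ x → ¬? (x ≟Sq (m ∸ 1 , n ∸ 1))) (rect m n)

module Submission where

-- Both regions, and every region the recursion produces from them, hang from
-- their full top row and are closed upward in each column.  Such a region is
-- connected and its top-left square c is its only northwest corner, so every
-- tiling starts with the east or the south spotlight from c, and the rest is a
-- tiling of what remains; the remainders are again of the same kind.  Hence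
-- the number of tilings is the sum of the numbers for the two remainders,
-- except for a single square, where both spotlights coincide.

open import Defs
open import Data.Nat using (ℕ; zero; suc; _+_; _*_; _∸_; _≤_; _<_; z≤n; s≤s)
open import Data.Nat.Properties using (+-comm; +-assoc; +-suc; +-identityʳ; ≤-refl; ≤-trans; <-trans; ≤-<-trans; <-≤-trans; <⇒≤; ≤-antisym; <-irrefl; ≤∧≢⇒<; ≤-total; <-cmp; m≤n⇒m<n∨m≡n; n≤1+n; n<1+n; m<1+n⇒m≤n; m≤m+n; m<m+n; +-monoʳ-<; +-cancelˡ-<; m+[n∸m]≡n; m+n∸m≡n; m+1+n≢m; 1+n≢n; +-commutativeSemigroup)
open import Data.Nat.Combinatorics using (_C_; nCn≡1; nC1≡n; nCk≡nC[n∸k]; nCk+nC[k+1]≡[n+1]C[k+1])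
open import Data.Product using (Σ; _×_; _,_; proj₁; proj₂; ∃; swap)
open import Data.Sum using (_⊎_; inj₁; inj₂)
open import Data.Empty using (⊥; ⊥-elim)
open import Data.List using (List; []; _∷_; _++_; map; upTo; filter)
open import Data.List.Properties using (++-identityʳ; length-++; length-map)
open import Data.List.Membership.Propositional using (_∈_; _∉_; find; lose)
open import Data.List.Membership.Propositional.Properties using (∈-map⁺; ∈-map⁻; ∈-upTo⁺; ∈-upTo⁻; ∈-++⁺ˡ; ∈-++⁺ʳ; ∈-++⁻; ∈-filter⁺; ∈-filter⁻; ∈-concatMap⁺; ∈-concatMap⁻)
open import Data.List.Membership.DecPropositional _≟Sq_ using (_∈?_)
open import Data.List.Relation.Unary.All as All using (All; []; _∷_)
open import Data.List.Relation.Unary.All.Properties as AllP using ()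
open import Data.List.Relation.Unary.Any as Any using (Any; here; there)
open import Data.List.Relation.Unary.Any.Properties as AnyP using ()
open import Data.List.Relation.Unary.AllPairs using (AllPairs; []; _∷_)
open import Data.List.Relation.Unary.AllPairs.Properties as AllPairsP using ()
open import Relation.Binary.PropositionalEquality using (_≡_; _≢_; refl; sym; trans; cong; cong₂; subst; module ≡-Reasoning)
open import Relation.Binary using (tri<; tri≈; tri>)
open import Relation.Nullary using (¬_; Dec)
open import Relation.Nullary.Decidable using (¬?)
open import Function using (id; _∘_)
open import Algebra.Properties.CommutativeSemigroup +-commutativeSemigroup using (interchange)

≋-refl : ∀ {A} → A ≋ A
≋-refl x = id , id

≋-sym : ∀ {A B} → A ≋ B → B ≋ A
≋-sym e x = swap (e x)

≋-trans : ∀ {A B C} → A ≋ B → B ≋ C → A ≋ C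
≋-trans e f x = proj₁ (f x) ∘ proj₁ (e x) , proj₂ (e x) ∘ proj₂ (f x)

Remainder : SqSet → SqSet → SqSet → Set
Remainder R S U = ∀ x → (x ∈ U → x ∈ R × x ∉ S) × (x ∈ R × x ∉ S → x ∈ U)

minus : SqSet → SqSet → SqSet
minus R S = filter (λ x → ¬? (x ∈? S)) R

minus-remainder : ∀ R S → Remainder R S (minus R S)
minus-remainder R S x = ∈-filter⁻ (λ x → ¬? (x ∈? S)) , λ (r , s) → ∈-filter⁺ (λ x → ¬? (x ∈? S)) r s

nwCorner-≋ : ∀ {R R′ s} → R ≋ R′ → NWCorner R s → NWCorner R′ s
nwCorner-≋ e (s∈ , above , left) =
  proj₁ (e _) s∈ , (λ i p q → above i p (proj₂ (e _) q)) , (λ j p q → left j p (proj₂ (e _) q))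

spotlight-≋ : ∀ {R R′ s d S} → R ≋ R′ → Spotlight R s d S → Spotlight R′ s d S
spotlight-≋ e (k , inside , outside , S≡) =
  k , (λ t t≤k → proj₁ (e _) (inside t t≤k)) , outside ∘ proj₂ (e _) , S≡

tiling-≋ : ∀ {R R′ T} → R ≋ R′ → SpotlightTiling R T → SpotlightTiling R′ T
tiling-≋ e (empty void) = empty (λ x → void x ∘ proj₂ (e x))
tiling-≋ e (place s d S U T nw sp rem ct) =
  place s d S U T (nwCorner-≋ e nw) (spotlight-≋ e sp) rem′ ct
  where
  rem′ : Remainder _ S U
  rem′ x = (λ u → let (r , s∉) = proj₁ (rem x) u in proj₁ (e x) r , s∉)
         , (λ (r , s∉) → proj₂ (rem x) (proj₂ (e x) r , s∉))

Piece : SqSet → SqSet → Set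
Piece R X = (∃ λ x → x ∈ X) × (∀ {x} → x ∈ X → x ∈ R)

piece-mono : ∀ {R R′} → (∀ {x} → x ∈ R → x ∈ R′) → ∀ {X} → Piece R X → Piece R′ X
piece-mono R⊆R′ (nonempty , X⊆R) = nonempty , R⊆R′ ∘ X⊆R

spotlight-piece : ∀ {R s d S} → Spotlight R s d S → Piece R S
spotlight-piece {R} {s} {d} (k , inside , outside , refl) =
  (shift d s 0 , ∈-map⁺ (shift d s) (∈-upTo⁺ (s≤s z≤n))) ,
  λ q → let (t , t∈ , x≡) = ∈-map⁻ (shift d s) q in
        subst (_∈ R) (sym x≡) (inside t (m<1+n⇒m≤n (∈-upTo⁻ t∈)))

mutual
  tiling-pieces : ∀ {R T} → SpotlightTiling R T → All (Piece R) T
  tiling-pieces (empty _) = []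
  tiling-pieces (place s d S U T nw sp rem ct) =
    spotlight-piece sp ∷ All.map (piece-mono (proj₁ ∘ proj₁ (rem _))) (components-pieces ct)

  components-pieces : ∀ {U T} → ComponentsTiling U T → All (Piece U) T
  components-pieces (none _) = []
  components-pieces (comp A B TA TB _ _ _ U≋A++B tA tB) =
    AllP.++⁺ (All.map (piece-mono (λ a → proj₂ (U≋A++B _) (∈-++⁺ˡ a))) (tiling-pieces tA))
             (All.map (piece-mono (λ b → proj₂ (U≋A++B _) (∈-++⁺ʳ A b))) (components-pieces tB))

tiling-of-empty : ∀ {R T} → (∀ x → x ∉ R) → SpotlightTiling R T → T ≡ []
tiling-of-empty void (empty _) = refl
tiling-of-empty void (place s _ _ _ _ (s∈ , _) _ _ _) = ⊥-elim (void s s∈)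

components-of-empty : ∀ {U T} → (∀ x → x ∉ U) → ComponentsTiling U T → T ≡ []
components-of-empty void (none _) = refl
components-of-empty void (comp A B _ _ (a , a∈) _ _ U≋A++B _ _) = ⊥-elim (void a (proj₂ (U≋A++B a) (∈-++⁺ˡ a∈)))

adj-sym : ∀ {x y} → Adj x y → Adj y x
adj-sym (inj₁ (refl , inj₁ p)) = inj₁ (refl , inj₂ p)
adj-sym (inj₁ (refl , inj₂ p)) = inj₁ (refl , inj₁ p)
adj-sym (inj₂ (refl , inj₁ p)) = inj₂ (refl , inj₂ p)
adj-sym (inj₂ (refl , inj₂ p)) = inj₂ (refl , inj₁ p)

_▸_ : ∀ {R x y z} → Path R x y → Path R y z → Path R x z
here ▸ q = q
step a m p ▸ q = step a m (p ▸ q)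

path-reverse : ∀ {R x y} → x ∈ R → Path R x y → Path R y x
path-reverse x∈ here = here
path-reverse x∈ (step xy y∈ p) = path-reverse y∈ p ▸ step (adj-sym xy) x∈ here

no-path-across : ∀ {R A B x y} → (∀ z → z ∈ R → z ∈ A ⊎ z ∈ B) →
  (∀ a b → a ∈ A → b ∈ B → a ≢ b × ¬ Adj a b) → Path R x y → x ∈ A → y ∈ B → ⊥
no-path-across cover sep here x∈A y∈B = proj₁ (sep _ _ x∈A y∈B) refl
no-path-across cover sep (step xz z∈ p) x∈A y∈B with cover _ z∈
... | inj₁ z∈A = no-path-across cover sep p z∈A y∈B
... | inj₂ z∈B = proj₂ (sep _ _ x∈A z∈B) xz

-- Regions that are empty or connected are their own (only) component, so
-- tiling their components is the same as tiling them.
EmptyOrConnected : SqSet → Set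
EmptyOrConnected R = (∀ x → x ∉ R) ⊎ ((∃ λ a → a ∈ R) × Connected R)

tiling⇒components : ∀ {R T} → EmptyOrConnected R → SpotlightTiling R T → ComponentsTiling R T
tiling⇒components (inj₁ void) t rewrite tiling-of-empty void t = none void
tiling⇒components {R} {T} (inj₂ (nonempty , conn)) t =
  subst (ComponentsTiling R) (++-identityʳ T)
    (comp R [] T [] nonempty conn (λ _ _ _ ()) R≋R++[] t (none (λ _ ())))
  where
  R≋R++[] : R ≋ (R ++ [])
  R≋R++[] x = subst (x ∈_) (sym (++-identityʳ R)) , subst (x ∈_) (++-identityʳ R)

components⇒tiling : ∀ {R U T} → EmptyOrConnected R → U ≋ R → ComponentsTiling U T → SpotlightTiling R T
components⇒tiling _ U≋R (none void) = empty (λ x → void x ∘ proj₂ (U≋R x))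
components⇒tiling (inj₁ void) U≋R (comp A B _ _ (a , a∈) _ _ U≋A++B _ _) =
  ⊥-elim (void a (proj₁ (U≋R a) (proj₂ (U≋A++B a) (∈-++⁺ˡ a∈))))
components⇒tiling {R} (inj₂ (_ , conn)) U≋R (comp A B TA TB (a , a∈) _ sep U≋A++B tA tB) =
  subst (SpotlightTiling R) (sym TA++TB≡TA) (tiling-≋ A≋R tA)
  where
  into-R : ∀ {x} → x ∈ A ++ B → x ∈ R
  into-R {x} = proj₁ (U≋R x) ∘ proj₂ (U≋A++B x)
  cover : ∀ x → x ∈ R → x ∈ A ⊎ x ∈ B
  cover x = ∈-++⁻ A ∘ proj₁ (U≋A++B x) ∘ proj₂ (U≋R x)
  B-empty : ∀ x → x ∉ B
  B-empty b b∈ = no-path-across cover sep (conn a b (into-R (∈-++⁺ˡ a∈)) (into-R (∈-++⁺ʳ A b∈))) a∈ b∈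
  TA++TB≡TA : TA ++ TB ≡ TA
  TA++TB≡TA = trans (cong (TA ++_) (components-of-empty B-empty tB)) (++-identityʳ TA)
  only-A : ∀ {x} → x ∈ A ⊎ x ∈ B → x ∈ A
  only-A (inj₁ x∈A) = x∈A
  only-A (inj₂ x∈B) = ⊥-elim (B-empty _ x∈B)
  A≋R : A ≋ R
  A≋R x = into-R ∘ ∈-++⁺ˡ , only-A ∘ cover x

run : Sq → Dir → ℕ → SqSet
run s d k = map (shift d s) (upTo (suc k))

MaxRun : SqSet → Sq → Dir → ℕ → Set
MaxRun R s d k = (∀ t → t ≤ k → shift d s t ∈ R) × shift d s (suc k) ∉ R

maxRun-spotlight : ∀ {R s d k} → MaxRun R s d k → Spotlight R s d (run s d k)
maxRun-spotlight {k = k} (inside , outside) = k , inside , outside , refl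

spotlight-unique : ∀ {R s d k S} → MaxRun R s d k → Spotlight R s d S → S ≡ run s d k
spotlight-unique {k = k} (inside , outside) (k′ , inside′ , outside′ , S≡) with <-cmp k′ k
... | tri< k′<k _ _ = ⊥-elim (outside′ (inside (suc k′) k′<k))
... | tri≈ _ refl _ = S≡
... | tri> _ _ k<k′ = ⊥-elim (outside (inside′ (suc k) k<k′))

shift-zero : ∀ d s → shift d s 0 ≡ s
shift-zero east (i , j) = cong (i ,_) (+-identityʳ j)
shift-zero south (i , j) = cong (_, j) (+-identityʳ i)

shift-suc≢ : ∀ d s t → shift d s (suc t) ≢ s
shift-suc≢ east (i , j) t = m+1+n≢m j ∘ cong proj₂
shift-suc≢ south (i , j) t = m+1+n≢m i ∘ cong proj₁

start∈run : ∀ s d k → s ∈ run s d k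
start∈run s d k = subst (_∈ run s d k) (shift-zero d s) (∈-map⁺ (shift d s) (∈-upTo⁺ (s≤s z≤n)))

same-refl : ∀ {T} → SameTiling T T
same-refl S = id , id

same-cons : ∀ {X Y T T′} → X ≋ Y → SameTiling T T′ → SameTiling (X ∷ T) (Y ∷ T′)
same-cons {X} {Y} {T} {T′} X≋Y T~T′ S = forth , back
  where
  forth : Any (_≋ S) (X ∷ T) → Any (_≋ S) (Y ∷ T′)
  forth (here X≋S) = here (≋-trans (≋-sym X≋Y) X≋S)
  forth (there p) = there (proj₁ (T~T′ S) p)
  back : Any (_≋ S) (Y ∷ T′) → Any (_≋ S) (X ∷ T)
  back (here Y≋S) = here (≋-trans X≋Y Y≋S)
  back (there p) = there (proj₂ (T~T′ S) p)

piece-member : ∀ {R T Y} → All (Piece R) T → Any (_≋ Y) T → ∀ {x} → x ∈ Y → x ∈ R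
piece-member ((_ , X⊆R) ∷ _) (here X≋Y) y = X⊆R (proj₂ (X≋Y _) y)
piece-member (_ ∷ pieces) (there p) y = piece-member pieces p y

piece-nonempty : ∀ {R T Y} → All (Piece R) T → Any (_≋ Y) T → ∃ λ x → x ∈ Y
piece-nonempty (((x , x∈) , _) ∷ _) (here X≋Y) = x , proj₁ (X≋Y x) x∈
piece-nonempty (_ ∷ pieces) (there p) = piece-nonempty pieces p

same-uncons : ∀ {R S T₁ T₂} → All (Piece R) T₁ → All (Piece R) T₂ →
  (∀ {x} → x ∈ R → x ∉ S) → SameTiling (S ∷ T₁) (S ∷ T₂) → SameTiling T₁ T₂
same-uncons {R} {S} pieces₁ pieces₂ R∩S=∅ same Y =
  cancel pieces₁ (proj₁ (same Y)) , cancel pieces₂ (proj₂ (same Y))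
  where
  cancel : ∀ {A B} → All (Piece R) A → (Any (_≋ Y) (S ∷ A) → Any (_≋ Y) (S ∷ B)) →
           Any (_≋ Y) A → Any (_≋ Y) B
  cancel pieces f p with f (there p)
  ... | there q = q
  ... | here S≋Y = let (x , x∈Y) = piece-nonempty pieces p in
                   ⊥-elim (R∩S=∅ (piece-member pieces p x∈Y) (proj₂ (S≋Y x) x∈Y))

num-empty : ∀ {R} → (∀ x → x ∉ R) → NumSpotlightTilings R 1
num-empty void =
  ([] ∷ []) , refl , (empty void ∷ []) ,
  (λ T t → here (subst (λ T′ → SameTiling T′ []) (sym (tiling-of-empty void t)) same-refl)) ,
  ([] ∷ [])

num-single : ∀ {R c} → c ∈ R → (∀ {x} → x ∈ R → x ≡ c) → NumSpotlightTilings R 1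
num-single {R} {c} c∈ only =
  (tiling ∷ []) , refl , (place c east (run c east 0) [] [] corner (maxRun-spotlight {d = east} (one east)) rest (none (λ _ ())) ∷ []) ,
  complete , ([] ∷ [])
  where
  tiling : Tiling
  tiling = run c east 0 ∷ []
  corner : NWCorner R c
  corner = c∈ , (λ i p q → 1+n≢n (trans p (sym (cong proj₁ (only q))))) ,
                (λ j p q → 1+n≢n (trans p (sym (cong proj₂ (only q)))))
  one : ∀ d → MaxRun R c d 0
  one d = (λ { zero _ → subst (_∈ R) (sym (shift-zero d c)) c∈ }) ,
          (λ q → shift-suc≢ d c 0 (only q))
  covered : ∀ d {x} → x ∈ R → x ∉ run c d 0 → ⊥
  covered d x∈ x∉ = x∉ (subst (_∈ run c d 0) (sym (only x∈)) (start∈run c d 0))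
  rest : Remainder R (run c east 0) []
  rest x = (λ ()) , (λ (x∈ , x∉) → ⊥-elim (covered east x∈ x∉))
  same-square : ∀ d → run c d 0 ≋ run c east 0
  same-square d x = (λ { (here refl) → here (trans (shift-zero d c) (sym (shift-zero east c))) }) ,
                    (λ { (here refl) → here (trans (shift-zero east c) (sym (shift-zero d c))) })
  complete : ∀ T → SpotlightTiling R T → Any (SameTiling T) (tiling ∷ [])
  complete T (empty void) = ⊥-elim (void c c∈)
  complete T (place s d S U T′ (s∈ , _) sp rem ct) with only s∈
  ... | refl with spotlight-unique (one d) sp
  ... | refl = here (same-cons (same-square d) (subst (λ Z → SameTiling Z []) (sym (components-of-empty U-empty ct)) same-refl))
    where
    U-empty : ∀ x → x ∉ U
    U-empty x u = let (x∈ , x∉) = proj₁ (rem x) u in covered d x∈ x∉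

prefixed : Sq → Dir → ℕ → List Tiling → List Tiling
prefixed c d k = map (run c d k ∷_)

module Prefixed {R c d k R′} (corner : NWCorner R c) (max : MaxRun R c d k)
                (rem : Remainder R (run c d k) R′) (ec : EmptyOrConnected R′) where

  valid : ∀ {L} → All (SpotlightTiling R′) L → All (SpotlightTiling R) (prefixed c d k L)
  valid ts = AllP.map⁺ (All.map (λ {T} t → place c d _ R′ T corner (maxRun-spotlight max) rem (tiling⇒components ec t)) ts)

  outside : ∀ {x} → x ∈ R′ → x ∉ run c d k
  outside x∈ = proj₂ (proj₁ (rem _) x∈)

  distinct : ∀ {L} → All (SpotlightTiling R′) L → AllPairs (λ T T′ → ¬ SameTiling T T′) L →
             AllPairs (λ T T′ → ¬ SameTiling T T′) (prefixed c d k L)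
  distinct [] [] = []
  distinct (t ∷ ts) (ds ∷ dss) = head ts ds ∷ distinct ts dss
    where
    head : ∀ {L} → All (SpotlightTiling R′) L → All (λ T′ → ¬ SameTiling _ T′) L →
           All (λ T′ → ¬ SameTiling (run c d k ∷ _) T′) (prefixed c d k L)
    head [] [] = []
    head (t′ ∷ ts′) (d ∷ ds′) =
      (d ∘ same-uncons (tiling-pieces t) (tiling-pieces t′) outside) ∷ head ts′ ds′

  complete : ∀ {N S U T} → (num : NumSpotlightTilings R′ N) → Spotlight R c d S →
             Remainder R S U → ComponentsTiling U T →
             Any (SameTiling (S ∷ T)) (prefixed c d k (proj₁ num))
  complete {U = U} {T} (L , _ , _ , all-in-L , _) sp remU ct with spotlight-unique max sp
  ... | refl = AnyP.map⁺ (Any.map (same-cons ≋-refl) (all-in-L T (components⇒tiling ec U≋R′ ct)))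
    where
    U≋R′ : U ≋ R′
    U≋R′ x = proj₂ (rem x) ∘ proj₁ (remU x) , proj₂ (remU x) ∘ proj₁ (rem x)

num-split : ∀ {R c} → NWCorner R c → (∀ s → NWCorner R s → s ≡ c) →
  ∀ {kₑ kₛ} → MaxRun R c east kₑ → MaxRun R c south kₛ →
  ¬ (run c south kₛ ≋ run c east kₑ) →
  ∀ {Rₑ Rₛ} → Remainder R (run c east kₑ) Rₑ → Remainder R (run c south kₛ) Rₛ →
  EmptyOrConnected Rₑ → EmptyOrConnected Rₛ →
  ∀ {Nₑ Nₛ} → NumSpotlightTilings Rₑ Nₑ → NumSpotlightTilings Rₛ Nₛ →
  NumSpotlightTilings R (Nₑ + Nₛ)
num-split {R} {c} corner unique {kₑ} {kₛ} maxₑ maxₛ differ {Rₑ} {Rₛ} remₑ remₛ ecₑ ecₛ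
          numₑ@(Lₑ , lenₑ , validₑ , _ , distinctₑ) numₛ@(Lₛ , lenₛ , validₛ , _ , distinctₛ) =
  Pₑ ++ Pₛ ,
  trans (length-++ Pₑ) (cong₂ _+_ (trans (length-map _ Lₑ) lenₑ) (trans (length-map _ Lₛ) lenₛ)) ,
  AllP.++⁺ (E.valid validₑ) (S.valid validₛ) ,
  complete ,
  AllPairsP.++⁺ (E.distinct validₑ distinctₑ) (S.distinct validₛ distinctₛ) across
  where
  module E = Prefixed {d = east} corner maxₑ remₑ ecₑ
  module S = Prefixed {d = south} corner maxₛ remₛ ecₛ
  Pₑ Pₛ : List Tiling
  Pₑ = prefixed c east kₑ Lₑ
  Pₛ = prefixed c south kₛ Lₛ

  complete : ∀ T → SpotlightTiling R T → Any (SameTiling T) (Pₑ ++ Pₛ)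
  complete T (empty void) = ⊥-elim (void c (proj₁ corner))
  complete T (place s east S U T′ nw sp rem ct) with unique s nw
  ... | refl = AnyP.++⁺ˡ (E.complete numₑ sp rem ct)
  complete T (place s south S U T′ nw sp rem ct) with unique s nw
  ... | refl = AnyP.++⁺ʳ Pₑ (S.complete numₛ sp rem ct)

  -- The first spotlights differ, and the south one cannot reappear later in
  -- an east-first tiling since c lies in it but not in Rₑ.
  east≁south : ∀ {T₁ T₂} → All (Piece Rₑ) T₁ → All (Piece Rₛ) T₂ →
               ¬ SameTiling (run c east kₑ ∷ T₁) (run c south kₛ ∷ T₂)
  east≁south pieces₁ pieces₂ same with proj₁ (same (run c east kₑ)) (here ≋-refl)
  ... | here south≋east = differ south≋east
  ... | there p = proj₂ (proj₁ (remₛ c) (piece-member pieces₂ p (start∈run c east kₑ))) (start∈run c south kₛ)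

  across : All (λ T → All (λ T′ → ¬ SameTiling T T′) Pₛ) Pₑ
  across = AllP.map⁺ (All.map (λ t₁ → AllP.map⁺ (All.map (λ t₂ → east≁south (tiling-pieces t₁) (tiling-pieces t₂)) validₛ)) validₑ)

InRange : ℕ → ℕ → ℕ → Set
InRange a m i = a ≤ i × i < a + m

range-empty : ∀ {a i} → ¬ InRange a 0 i
range-empty {a} {i} (a≤i , i<a) = <-irrefl refl (<-≤-trans (subst (i <_) (+-identityʳ a) i<a) a≤i)

range-start : ∀ {a m} → InRange a (suc m) a
range-start {a} = ≤-refl , m<m+n a (s≤s z≤n)

range-offset : ∀ {a m t} → t < m → InRange a m (a + t)
range-offset {a} {t = t} t<m = m≤m+n a t , +-monoʳ-< a t<m

range-past : ∀ {a m} → ¬ InRange a m (a + m)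
range-past (_ , past) = <-irrefl refl past

range-one : ∀ {a i} → InRange a 1 i → i ≡ a
range-one {a} {i} (a≤i , i<a+1) = ≤-antisym (m<1+n⇒m≤n (subst (i <_) (trans (+-suc a 0) (cong suc (+-identityʳ a))) i<a+1)) a≤i

range-drop-first : ∀ {a m i} → InRange a (suc m) i → i ≢ a → InRange (suc a) m i
range-drop-first {a} {m} {i} (a≤i , i<) i≢a = ≤∧≢⇒< a≤i (i≢a ∘ sym) , subst (i <_) (+-suc a m) i<

range-add-first : ∀ {a m i} → InRange (suc a) m i → InRange a (suc m) i × i ≢ a
range-add-first {a} {m} {i} (a<i , i<) = (<⇒≤ a<i , subst (i <_) (sym (+-suc a m)) i<) , λ i≡a → <-irrefl (sym i≡a) a<i

range-drop-last : ∀ {a m i} → InRange a (suc m) i → i ≢ a + m → InRange a m i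
range-drop-last {a} {m} {i} (a≤i , i<) i≢last = a≤i , ≤∧≢⇒< (m<1+n⇒m≤n (subst (i <_) (+-suc a m) i<)) i≢last

range-add-last : ∀ {a m i} → InRange a m i → InRange a (suc m) i × i ≢ a + m
range-add-last {a} {m} (a≤i , i<) = (a≤i , <-trans i< (+-monoʳ-< a (n<1+n m))) , λ i≡last → <-irrefl i≡last i<

-- A region that hangs from its top row: R lies in rows ≥ a and columns
-- [b, b+w), contains the whole top row segment, and is closed upward in each
-- column.  All regions met in the recursion are of this kind.
record Hanging (R : SqSet) (a b w : ℕ) : Set where
  field
    bounds    : ∀ {i j} → (i , j) ∈ R → a ≤ i × InRange b w j
    top-row   : ∀ {j} → InRange b w j → (a , j) ∈ R
    up-closed : ∀ {i j k} → (i , j) ∈ R → a ≤ k → k ≤ i → (k , j) ∈ R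

module _ {R a b w} (h : Hanging R a b w) where
  open Hanging h

  hanging-unique-corner : ∀ s → NWCorner R s → s ≡ (a , b)
  hanging-unique-corner (i , j) (s∈ , above , left) with bounds s∈
  ... | a≤i , b≤j , j< with m≤n⇒m<n∨m≡n a≤i
  hanging-unique-corner (suc i , j) (s∈ , above , left) | _ | inj₁ (s≤s a≤i) =
    ⊥-elim (above i refl (up-closed s∈ a≤i (n≤1+n i)))
  ... | inj₂ refl with m≤n⇒m<n∨m≡n b≤j
  hanging-unique-corner (i , suc j) (s∈ , above , left) | _ , _ , j< | inj₂ refl | inj₁ (s≤s b≤j) =
    ⊥-elim (left j refl (top-row (b≤j , <-trans (n<1+n j) j<)))
  ... | inj₂ refl = refl

  path-up : ∀ {i j} → (i , j) ∈ R → Path R (i , j) (a , j)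
  path-up {i} s∈ with m≤n⇒m<n∨m≡n (proj₁ (bounds s∈))
  ... | inj₂ refl = here
  path-up {suc i} {j} s∈ | inj₁ (s≤s a≤i) = step (inj₂ (refl , inj₂ refl)) above∈ (path-up above∈)
    where
    above∈ : (i , j) ∈ R
    above∈ = up-closed s∈ a≤i (n≤1+n i)

  path-along-top : ∀ {j j′} → b ≤ j → j ≤ j′ → j′ < b + w → Path R (a , j) (a , j′)
  path-along-top {j} {j′} b≤j j≤j′ j′< with m≤n⇒m<n∨m≡n j≤j′
  ... | inj₂ refl = here
  path-along-top {j} {suc j′} b≤j _ j′< | inj₁ (s≤s j≤j′) =
    path-along-top b≤j j≤j′ (<-trans (n<1+n j′) j′<) ▸
    step (inj₁ (refl , inj₁ refl)) (top-row (≤-trans b≤j (≤-trans j≤j′ (n≤1+n j′)) , j′<)) here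

  hanging-connected : Connected R
  hanging-connected (i , j) (i′ , j′) s∈ s′∈ with bounds s∈ | bounds s′∈
  ... | _ , b≤j , j< | _ , b≤j′ , j′< = path-up s∈ ▸ (along ▸ path-reverse s′∈ (path-up s′∈))
    where
    along : Path R (a , j) (a , j′)
    along with ≤-total j j′
    ... | inj₁ j≤j′ = path-along-top b≤j j≤j′ j′<
    ... | inj₂ j′≤j = path-reverse (top-row (b≤j′ , j′<)) (path-along-top b≤j′ j′≤j j<)

module _ {R a b n} (h : Hanging R a b (suc n)) where
  open Hanging h

  hanging-corner : NWCorner R (a , b)
  hanging-corner = top-row range-start ,
                   (λ { i refl q → <-irrefl refl (proj₁ (bounds q)) }) ,
                   (λ { j refl q → <-irrefl refl (proj₁ (proj₂ (bounds q))) })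

  hanging-ec : EmptyOrConnected R
  hanging-ec = inj₂ (((a , b) , top-row range-start) , hanging-connected h)

Rep : SqSet → (Sq → Set) → Set
Rep R P = ∀ x → (x ∈ R → P x) × (P x → x ∈ R)

_≐_ : (Sq → Set) → (Sq → Set) → Set
P ≐ Q = ∀ x → (P x → Q x) × (Q x → P x)

rep-≐ : ∀ {R P Q} → Rep R P → P ≐ Q → Rep R Q
rep-≐ rep P≐Q x = proj₁ (P≐Q x) ∘ proj₁ (rep x) , proj₂ (rep x) ∘ proj₂ (P≐Q x)

rep-minus : ∀ {R S P Q} → Rep R P → Rep S Q → Rep (minus R S) (λ x → P x × ¬ Q x)
rep-minus {R} {S} repR repS x =
  (λ q → let (r , s∉) = proj₁ (minus-remainder R S x) q in proj₁ (repR x) r , s∉ ∘ proj₂ (repS x)) ,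
  (λ (p , ¬q) → proj₂ (minus-remainder R S x) (proj₂ (repR x) p , ¬q ∘ proj₁ (repS x)))

rep-empty : ∀ {R P} → Rep R P → (∀ x → ¬ P x) → ∀ x → x ∉ R
rep-empty rep ¬P x = ¬P x ∘ proj₁ (rep x)

rep-maxRun : ∀ {R P s d k} → Rep R P →
  (∀ t → t ≤ k → P (shift d s t)) → ¬ P (shift d s (suc k)) → MaxRun R s d k
rep-maxRun rep inside outside = (λ t t≤k → proj₂ (rep _) (inside t t≤k)) , outside ∘ proj₁ (rep _)

InRect : ℕ → ℕ → ℕ → ℕ → Sq → Set
InRect a m b n (i , j) = InRange a m i × InRange b n j

run-east-rect : ∀ {a b k} → Rep (run (a , b) east k) (InRect a 1 b (suc k))
run-east-rect {a} {b} {k} (i , j) = forth , back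
  where
  forth : (i , j) ∈ run (a , b) east k → InRect a 1 b (suc k) (i , j)
  forth q with ∈-map⁻ (shift east (a , b)) q
  ... | t , t∈ , refl = range-start , range-offset (∈-upTo⁻ t∈)
  back : InRect a 1 b (suc k) (i , j) → (i , j) ∈ run (a , b) east k
  back (i∈ , b≤j , j<) =
    subst (_∈ run (a , b) east k) (cong₂ _,_ (sym (range-one i∈)) (m+[n∸m]≡n b≤j))
      (∈-map⁺ (shift east (a , b)) (∈-upTo⁺ (+-cancelˡ-< b _ _ (subst (_< b + suc k) (sym (m+[n∸m]≡n b≤j)) j<))))

run-south-rect : ∀ {a b k} → Rep (run (a , b) south k) (InRect a (suc k) b 1)
run-south-rect {a} {b} {k} (i , j) = forth , back
  where
  forth : (i , j) ∈ run (a , b) south k → InRect a (suc k) b 1 (i , j)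
  forth q with ∈-map⁻ (shift south (a , b)) q
  ... | t , t∈ , refl = range-offset (∈-upTo⁻ t∈) , range-start
  back : InRect a (suc k) b 1 (i , j) → (i , j) ∈ run (a , b) south k
  back ((a≤i , i<) , j∈) =
    subst (_∈ run (a , b) south k) (cong₂ _,_ (m+[n∸m]≡n a≤i) (sym (range-one j∈)))
      (∈-map⁺ (shift south (a , b)) (∈-upTo⁺ (+-cancelˡ-< a _ _ (subst (_< a + suc k) (sym (m+[n∸m]≡n a≤i)) i<))))

runs-distinct : ∀ {a b m n} → ¬ (m ≡ 0 × n ≡ 0) → ¬ (run (a , b) south m ≋ run (a , b) east n)
runs-distinct {m = zero} {zero} not-single _ = not-single (refl , refl)
runs-distinct {a} {b} {suc m} {n} _ same =
  m+1+n≢m a (range-one (proj₁ (proj₁ (run-east-rect _) (proj₁ (same _) below))))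
  where
  below : (a + 1 , b) ∈ run (a , b) south (suc m)
  below = proj₂ (run-south-rect _) (range-offset (s≤s (s≤s z≤n)) , range-start)
runs-distinct {a} {b} {zero} {suc n} _ same =
  m+1+n≢m b (range-one (proj₂ (proj₁ (run-south-rect _) (proj₂ (same _) right))))
  where
  right : (a , b + 1) ∈ run (a , b) east (suc n)
  right = proj₂ (run-east-rect _) (range-start , range-offset (s≤s (s≤s z≤n)))

split-at-corner : ∀ {R a b m n} → Hanging R a b (suc n) →
  MaxRun R (a , b) east n → MaxRun R (a , b) south m → ¬ (m ≡ 0 × n ≡ 0) →
  EmptyOrConnected (minus R (run (a , b) east n)) → EmptyOrConnected (minus R (run (a , b) south m)) →
  ∀ {Nₑ Nₛ} → NumSpotlightTilings (minus R (run (a , b) east n)) Nₑ →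
  NumSpotlightTilings (minus R (run (a , b) south m)) Nₛ → NumSpotlightTilings R (Nₑ + Nₛ)
split-at-corner h maxₑ maxₛ not-single =
  num-split (hanging-corner h) (hanging-unique-corner h) maxₑ maxₛ (runs-distinct not-single)
            (minus-remainder _ _) (minus-remainder _ _)

drop-top-row : ∀ {a m b w} → (λ x → InRect a (suc m) b w x × ¬ InRect a 1 b w x) ≐ InRect (suc a) m b w
drop-top-row {a} {m} {b} {w} (i , j) = forth , back
  where
  forth : InRect a (suc m) b w (i , j) × ¬ InRect a 1 b w (i , j) → InRect (suc a) m b w (i , j)
  forth ((i∈ , j∈) , not-top) =
    range-drop-first i∈ (λ i≡a → not-top (subst (InRange a 1) (sym i≡a) range-start , j∈)) , j∈
  back : InRect (suc a) m b w (i , j) → InRect a (suc m) b w (i , j) × ¬ InRect a 1 b w (i , j)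
  back (i∈ , j∈) = let (i∈′ , i≢a) = range-add-first i∈ in (i∈′ , j∈) , i≢a ∘ range-one ∘ proj₁

drop-left-column : ∀ {a h b n} → (λ x → InRect a h b (suc n) x × ¬ InRect a h b 1 x) ≐ InRect a h (suc b) n
drop-left-column {a} {h} {b} {n} (i , j) = forth , back
  where
  forth : InRect a h b (suc n) (i , j) × ¬ InRect a h b 1 (i , j) → InRect a h (suc b) n (i , j)
  forth ((i∈ , j∈) , not-left) =
    i∈ , range-drop-first j∈ (λ j≡b → not-left (i∈ , subst (InRange b 1) (sym j≡b) range-start))
  back : InRect a h (suc b) n (i , j) → InRect a h b (suc n) (i , j) × ¬ InRect a h b 1 (i , j)
  back (i∈ , j∈) = let (j∈′ , j≢b) = range-add-first j∈ in (i∈ , j∈′) , j≢b ∘ range-one ∘ proj₂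

module _ {R a b m n} (rep : Rep R (InRect a (suc m) b n)) where

  rect-hanging : Hanging R a b n
  rect-hanging = record
    { bounds    = λ {i} {j} s∈ → let ((a≤i , _) , j∈) = proj₁ (rep (i , j)) s∈ in a≤i , j∈
    ; top-row   = λ j∈ → proj₂ (rep _) (range-start , j∈)
    ; up-closed = λ {i} {j} s∈ a≤k k≤i → let ((_ , i<) , j∈) = proj₁ (rep (i , j)) s∈ in
                  proj₂ (rep _) ((a≤k , ≤-<-trans k≤i i<) , j∈) }

module _ {R a b m n} (rep : Rep R (InRect a (suc m) b (suc n))) where

  rect-east : MaxRun R (a , b) east n
  rect-east = rep-maxRun {s = a , b} {d = east} rep (λ t t≤n → range-start , range-offset (s≤s t≤n)) (range-past ∘ proj₂)

  rect-south : MaxRun R (a , b) south m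
  rect-south = rep-maxRun {s = a , b} {d = south} rep (λ t t≤m → range-offset (s≤s t≤m) , range-start) (range-past ∘ proj₁)

  rect-minus-east : Rep (minus R (run (a , b) east n)) (InRect (suc a) m b (suc n))
  rect-minus-east = rep-≐ (rep-minus rep run-east-rect) drop-top-row

  rect-minus-south : Rep (minus R (run (a , b) south m)) (InRect a (suc m) (suc b) n)
  rect-minus-south = rep-≐ (rep-minus rep run-south-rect) drop-left-column

rect-ec : ∀ m n {R a b} → Rep R (InRect a m b n) → EmptyOrConnected R
rect-ec zero n rep = inj₁ (rep-empty rep λ { (i , j) → range-empty ∘ proj₁ })
rect-ec (suc m) zero rep = inj₁ (rep-empty rep λ { (i , j) → range-empty ∘ proj₂ })
rect-ec (suc m) (suc n) rep = hanging-ec (rect-hanging rep)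

rectCount : ℕ → ℕ → ℕ
rectCount zero n = 1
rectCount (suc m) zero = 1
rectCount (suc zero) (suc zero) = 1
rectCount (suc m) (suc n) = rectCount m (suc n) + rectCount (suc m) n

rect-split : ∀ {R a b m n} → ¬ (m ≡ 0 × n ≡ 0) → (rep : Rep R (InRect a (suc m) b (suc n))) →
  ∀ {Nₑ Nₛ} → NumSpotlightTilings (minus R (run (a , b) east n)) Nₑ →
  NumSpotlightTilings (minus R (run (a , b) south m)) Nₛ → NumSpotlightTilings R (Nₑ + Nₛ)
rect-split not-single rep =
  split-at-corner (rect-hanging rep) (rect-east rep) (rect-south rep) not-single
    (rect-ec _ _ (rect-minus-east rep)) (rect-ec _ _ (rect-minus-south rep))

rect-count : ∀ m n {R a b} → Rep R (InRect a m b n) → NumSpotlightTilings R (rectCount m n)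
rect-count zero n rep = num-empty (rep-empty rep λ { (i , j) → range-empty ∘ proj₁ })
rect-count (suc m) zero rep = num-empty (rep-empty rep λ { (i , j) → range-empty ∘ proj₂ })
rect-count (suc zero) (suc zero) rep =
  num-single (proj₂ (rep _) (range-start , range-start))
             (λ { {i , j} s∈ → let (i∈ , j∈) = proj₁ (rep _) s∈ in cong₂ _,_ (range-one i∈) (range-one j∈) })
rect-count (suc zero) (suc (suc n)) rep =
  rect-split (λ ()) rep (rect-count 0 _ (rect-minus-east rep)) (rect-count 1 _ (rect-minus-south rep))
rect-count (suc (suc m)) (suc n) rep =
  rect-split (λ ()) rep (rect-count (suc m) _ (rect-minus-east rep)) (rect-count _ n (rect-minus-south rep))

InNotch : ℕ → ℕ → ℕ → ℕ → Sq → Set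
InNotch a p b q x = InRect a (suc p) b (suc q) x × x ≢ (a + p , b + q)

notch-row : ∀ {a b q} → InNotch a 0 b q ≐ InRect a 1 b q
notch-row {a} {b} {q} (i , j) = forth , back
  where
  forth : InNotch a 0 b q (i , j) → InRect a 1 b q (i , j)
  forth ((i∈ , j∈) , not-corner) =
    i∈ , range-drop-last j∈ (not-corner ∘ cong₂ _,_ (trans (range-one i∈) (sym (+-identityʳ a))))
  back : InRect a 1 b q (i , j) → InNotch a 0 b q (i , j)
  back (i∈ , j∈) = let (j∈′ , j≢) = range-add-last j∈ in (i∈ , j∈′) , j≢ ∘ cong proj₂

notch-column : ∀ {a p b} → InNotch a p b 0 ≐ InRect a p b 1
notch-column {a} {p} {b} (i , j) = forth , back
  where
  forth : InNotch a p b 0 (i , j) → InRect a p b 1 (i , j)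
  forth ((i∈ , j∈) , not-corner) =
    range-drop-last i∈ (λ i≡ → not-corner (cong₂ _,_ i≡ (trans (range-one j∈) (sym (+-identityʳ b))))) , j∈
  back : InRect a p b 1 (i , j) → InNotch a p b 0 (i , j)
  back (i∈ , j∈) = let (i∈′ , i≢) = range-add-last i∈ in (i∈′ , j∈) , i≢ ∘ cong proj₁

notch-drop-top-row : ∀ {a p b q} → (λ x → InNotch a (suc p) b q x × ¬ InRect a 1 b (suc q) x) ≐ InNotch (suc a) p b q
notch-drop-top-row {a} {p} {b} {q} x = forth , back
  where
  corner≡ : (a + suc p , b + q) ≡ (suc a + p , b + q)
  corner≡ = cong (_, b + q) (+-suc a p)
  forth : InNotch a (suc p) b q x × ¬ InRect a 1 b (suc q) x → InNotch (suc a) p b q x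
  forth ((r , not-corner) , not-top) = proj₁ (drop-top-row x) (r , not-top) , λ x≡ → not-corner (trans x≡ (sym corner≡))
  back : InNotch (suc a) p b q x → InNotch a (suc p) b q x × ¬ InRect a 1 b (suc q) x
  back (r , not-corner) = let (r′ , not-top) = proj₂ (drop-top-row x) r in
                          (r′ , λ x≡ → not-corner (trans x≡ corner≡)) , not-top

notch-drop-left-column : ∀ {a p b q} → (λ x → InNotch a p b (suc q) x × ¬ InRect a (suc p) b 1 x) ≐ InNotch a p (suc b) q
notch-drop-left-column {a} {p} {b} {q} x = forth , back
  where
  corner≡ : (a + p , b + suc q) ≡ (a + p , suc b + q)
  corner≡ = cong (a + p ,_) (+-suc b q)
  forth : InNotch a p b (suc q) x × ¬ InRect a (suc p) b 1 x → InNotch a p (suc b) q x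
  forth ((r , not-corner) , not-left) = proj₁ (drop-left-column x) (r , not-left) , λ x≡ → not-corner (trans x≡ (sym corner≡))
  back : InNotch a p (suc b) q x → InNotch a p b (suc q) x × ¬ InRect a (suc p) b 1 x
  back (r , not-corner) = let (r′ , not-left) = proj₂ (drop-left-column x) r in
                          (r′ , λ x≡ → not-corner (trans x≡ corner≡)) , not-left

module _ {R a p b q} (rep : Rep R (InNotch a (suc p) b q)) where

  -- With at least two rows, the notch is in the last row, so the region
  -- still hangs from its full top row.
  notch-hanging : Hanging R a b (suc q)
  notch-hanging = record
    { bounds    = λ {i} {j} s∈ → let (((a≤i , _) , j∈) , _) = proj₁ (rep (i , j)) s∈ in a≤i , j∈
    ; top-row   = λ j∈ → proj₂ (rep _) ((range-start , j∈) , m+1+n≢m a ∘ sym ∘ cong proj₁)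
    ; up-closed = up-closed }
    where
    up-closed : ∀ {i j k} → (i , j) ∈ R → a ≤ k → k ≤ i → (k , j) ∈ R
    up-closed {i} {j} {k} s∈ a≤k k≤i with proj₁ (rep (i , j)) s∈
    ... | ((_ , i<) , j∈) , not-corner = proj₂ (rep _) (((a≤k , ≤-<-trans k≤i i<) , j∈) , k-not-corner)
      where
      -- If (k , j) were the corner, the square (i , j) below it would be too.
      k-not-corner : (k , j) ≢ (a + suc p , b + q)
      k-not-corner k≡ = not-corner (cong₂ _,_
        (≤-antisym (m<1+n⇒m≤n (subst (i <_) (+-suc a (suc p)) i<)) (subst (_≤ i) (cong proj₁ k≡) k≤i))
        (cong proj₂ k≡))

  notch-east : MaxRun R (a , b) east q
  notch-east = rep-maxRun {s = a , b} {d = east} rep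
    (λ t t≤q → (range-start , range-offset (s≤s t≤q)) , m+1+n≢m a ∘ sym ∘ cong proj₁)
    (range-past ∘ proj₂ ∘ proj₁)

  notch-minus-east : Rep (minus R (run (a , b) east q)) (InNotch (suc a) p b q)
  notch-minus-east = rep-≐ (rep-minus rep run-east-rect) notch-drop-top-row

module _ {R a p b q} (rep : Rep R (InNotch a p b (suc q))) where

  notch-south : MaxRun R (a , b) south p
  notch-south = rep-maxRun {s = a , b} {d = south} rep
    (λ t t≤p → (range-offset (s≤s t≤p) , range-start) , m+1+n≢m b ∘ sym ∘ cong proj₂)
    (range-past ∘ proj₁ ∘ proj₁)

  notch-minus-south : Rep (minus R (run (a , b) south p)) (InNotch a p (suc b) q)
  notch-minus-south = rep-≐ (rep-minus rep run-south-rect) notch-drop-left-column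

notch-ec : ∀ p q {R a b} → Rep R (InNotch a p b q) → EmptyOrConnected R
notch-ec zero q rep = rect-ec 1 q (rep-≐ rep notch-row)
notch-ec (suc p) q rep = hanging-ec (notch-hanging rep)

notchCount : ℕ → ℕ → ℕ
notchCount zero q = rectCount 1 q
notchCount (suc p) zero = rectCount (suc p) 1
notchCount (suc p) (suc q) = notchCount p (suc q) + notchCount (suc p) q

notch-count : ∀ p q {R a b} → Rep R (InNotch a p b q) → NumSpotlightTilings R (notchCount p q)
notch-count zero q rep = rect-count 1 q (rep-≐ rep notch-row)
notch-count (suc p) zero rep = rect-count (suc p) 1 (rep-≐ rep notch-column)
notch-count (suc p) (suc q) rep =
  split-at-corner (notch-hanging rep) (notch-east rep) (notch-south rep) (λ { (() , _) })
    (notch-ec _ _ (notch-minus-east rep)) (notch-ec _ _ (notch-minus-south rep))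
    (notch-count p (suc q) (notch-minus-east rep)) (notch-count (suc p) q (notch-minus-south rep))

rect-rep : ∀ m n → Rep (rect m n) (InRect 0 m 0 n)
rect-rep m n (i , j) = forth , back
  where
  row : ℕ → SqSet
  row i = map (i ,_) (upTo n)
  forth : (i , j) ∈ rect m n → InRect 0 m 0 n (i , j)
  forth q with find (∈-concatMap⁻ row q)
  ... | i′ , i′∈ , in-row with ∈-map⁻ (i′ ,_) in-row
  ... | j′ , j′∈ , refl = (z≤n , ∈-upTo⁻ i′∈) , (z≤n , ∈-upTo⁻ j′∈)
  back : InRect 0 m 0 n (i , j) → (i , j) ∈ rect m n
  back ((_ , i<m) , (_ , j<n)) = ∈-concatMap⁺ row (lose (∈-upTo⁺ i<m) (∈-map⁺ (i ,_) (∈-upTo⁺ j<n)))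

rectMinusSE-rep : ∀ p q → Rep (rectMinusSE (2 + p) (2 + q)) (InNotch 0 (suc p) 0 (suc q))
rectMinusSE-rep p q x = forth , back
  where
  not-corner? : (x : Sq) → Dec (¬ x ≡ (suc p , suc q))
  not-corner? x = ¬? (x ≟Sq (suc p , suc q))
  forth : x ∈ rectMinusSE (2 + p) (2 + q) → InNotch 0 (suc p) 0 (suc q) x
  forth x∈ = let (r , not-corner) = ∈-filter⁻ not-corner? x∈ in proj₁ (rect-rep (2 + p) (2 + q) x) r , not-corner
  back : InNotch 0 (suc p) 0 (suc q) x → x ∈ rectMinusSE (2 + p) (2 + q)
  back (r , not-corner) = ∈-filter⁺ not-corner? (proj₂ (rect-rep (2 + p) (2 + q) x) r) not-corner

row-count : ∀ n → rectCount 1 (suc n) ≡ suc n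
row-count zero = refl
row-count (suc n) = cong suc (row-count n)

column-count : ∀ m → rectCount (suc m) 1 ≡ suc m
column-count zero = refl
column-count (suc m) = trans (+-comm (rectCount (suc m) 1) 1) (cong suc (column-count m))

choose-diagonal : ∀ n → (n + 0) C n ≡ 1
choose-diagonal n = trans (cong (_C n) (+-identityʳ n)) (nCn≡1 n)

choose-subdiagonal : ∀ n → (n + 1) C n ≡ n + 1
choose-subdiagonal n = begin
  (n + 1) C n             ≡⟨ nCk≡nC[n∸k] (m≤m+n n 1) ⟩
  (n + 1) C (n + 1 ∸ n)   ≡⟨ cong ((n + 1) C_) (m+n∸m≡n n 1) ⟩
  (n + 1) C 1             ≡⟨ nC1≡n (n + 1) ⟩
  n + 1                   ∎
  where open ≡-Reasoning

pascal-split : ∀ A B N k → (A + B) + suc N C suc k ≡ (A + N C k) + (B + N C suc k)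
pascal-split A B N k = begin
  (A + B) + suc N C suc k            ≡⟨ cong (A + B +_) (sym (nCk+nC[k+1]≡[n+1]C[k+1] N k)) ⟩
  (A + B) + (N C k + N C suc k)      ≡⟨ interchange A B (N C k) (N C suc k) ⟩
  (A + N C k) + (B + N C suc k)      ∎
  where open ≡-Reasoning

rect-closed : ∀ p q → rectCount (suc p) (suc q) + (p + q) C p ≡ suc (suc (p + q)) C suc p
rect-closed zero q = begin
  rectCount 1 (suc q) + 1   ≡⟨ cong (_+ 1) (row-count q) ⟩
  suc q + 1                 ≡⟨ +-comm (suc q) 1 ⟩
  suc (suc q)               ≡⟨ sym (nC1≡n (suc (suc q))) ⟩
  suc (suc q) C 1           ∎
  where open ≡-Reasoning
rect-closed (suc p) zero = begin
  rectCount (suc (suc p)) 1 + (suc p + 0) C suc p   ≡⟨ cong₂ _+_ (column-count (suc p)) (choose-diagonal (suc p)) ⟩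
  suc (suc p) + 1                                   ≡⟨ sym (choose-subdiagonal (suc (suc p))) ⟩
  (suc (suc p) + 1) C suc (suc p)                   ≡⟨ cong (λ k → suc (suc k) C suc (suc p)) (+-suc p 0) ⟩
  suc (suc (suc p + 0)) C suc (suc p)               ∎
  where open ≡-Reasoning
rect-closed (suc p) (suc q) = begin
  rectCount (suc (suc p)) (suc (suc q)) + suc N C suc p
    ≡⟨ pascal-split (rectCount (suc p) (suc (suc q))) (rectCount (suc (suc p)) (suc q)) N p ⟩
  (rectCount (suc p) (suc (suc q)) + N C p) + (rectCount (suc (suc p)) (suc q) + N C suc p)
    ≡⟨ cong₂ _+_ (rect-closed p (suc q)) shifted ⟩
  suc (suc N) C suc p + suc (suc N) C suc (suc p)
    ≡⟨ nCk+nC[k+1]≡[n+1]C[k+1] (suc (suc N)) (suc p) ⟩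
  suc (suc (suc N)) C suc (suc p)   ∎
  where
  open ≡-Reasoning
  N : ℕ
  N = p + suc q
  shifted : rectCount (suc (suc p)) (suc q) + N C suc p ≡ suc (suc N) C suc (suc p)
  shifted = subst (λ k → rectCount (suc (suc p)) (suc q) + k C suc p ≡ suc (suc k) C suc (suc p))
                  (sym (+-suc p q)) (rect-closed (suc p) q)

notch-closed : ∀ p q → ¬ (p ≡ 0 × q ≡ 0) → notchCount p q + (p + q) C p ≡ rectCount (suc p) (suc q)
notch-closed zero zero not-single = ⊥-elim (not-single (refl , refl))
notch-closed zero (suc q) _ = +-comm (rectCount 1 (suc q)) 1
notch-closed (suc p) zero _ = cong (rectCount (suc p) 1 +_) (choose-diagonal (suc p))
notch-closed (suc p) (suc q) _ = begin
  notchCount (suc p) (suc q) + suc N C suc p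
    ≡⟨ pascal-split (notchCount p (suc q)) (notchCount (suc p) q) N p ⟩
  (notchCount p (suc q) + N C p) + (notchCount (suc p) q + N C suc p)
    ≡⟨ cong₂ _+_ (notch-closed p (suc q) (λ { (_ , ()) })) shifted ⟩
  rectCount (suc (suc p)) (suc (suc q))   ∎
  where
  open ≡-Reasoning
  N : ℕ
  N = p + suc q
  shifted : notchCount (suc p) q + N C suc p ≡ rectCount (suc (suc p)) (suc q)
  shifted = subst (λ k → notchCount (suc p) q + k C suc p ≡ rectCount (suc (suc p)) (suc q))
                  (sym (+-suc p q)) (notch-closed (suc p) q (λ { (() , _) }))

proposition4p4 : ∀ m n → 2 ≤ m → 2 ≤ n →
    Σ ℕ λ k → Σ ℕ λ t →
      NumSpotlightTilings (rectMinusSE m n) k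
      × NumSpotlightTilings (rect m n) t
      × k + ((m + n ∸ 2) C (m ∸ 1)) ≡ t
      × k + 2 * ((m + n ∸ 2) C (m ∸ 1)) ≡ (m + n) C m
proposition4p4 (suc (suc m)) (suc (suc n)) _ _ =
  k , t , notch-count (suc m) (suc n) (rectMinusSE-rep m n) , rect-count _ _ (rect-rep (suc (suc m)) (suc (suc n))) ,
  corner-loss , total
  where
  open ≡-Reasoning
  k t c : ℕ
  k = notchCount (suc m) (suc n)
  t = rectCount (suc (suc m)) (suc (suc n))
  c = (m + suc (suc n)) C suc m
  c≡ : c ≡ (suc m + suc n) C suc m
  c≡ = cong (_C suc m) (+-suc m (suc n))
  corner-loss : k + c ≡ t
  corner-loss = trans (cong (k +_) c≡) (notch-closed (suc m) (suc n) (λ { (() , _) }))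
  total : k + 2 * c ≡ suc (suc (m + suc (suc n))) C suc (suc m)
  total = begin
    k + (c + (c + 0))   ≡⟨ cong (λ x → k + (c + x)) (+-identityʳ c) ⟩
    k + (c + c)         ≡⟨ sym (+-assoc k c c) ⟩
    (k + c) + c         ≡⟨ cong₂ _+_ corner-loss c≡ ⟩
    t + (suc m + suc n) C suc m   ≡⟨ rect-closed (suc m) (suc n) ⟩
    suc (suc (suc m + suc n)) C suc (suc m)   ≡⟨ cong (λ x → suc (suc x) C suc (suc m)) (sym (+-suc m (suc n))) ⟩
    suc (suc (m + suc (suc n))) C suc (suc m)   ∎
proposition4p4 (suc zero) _ (s≤s ()) _
proposition4p4 (suc (suc m)) (suc zero) _ (s≤s ())
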